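{- Let $n,\ell,k$ be positive integers with $\ell\ge 2^{k-1}$, and let $\phi$ be the edge-coloring of $P_n^\ell$ described in the context. If $v_iv_j$ ($i<j$) is an edge of $P_n^\ell$ whose window $(c_{i+1},\dots,c_j)$ has largest element $k$, then there is an edge $v_{i'}v_{j'}$ ($i'<j'$) of $P_n^\ell$ with $c_{j'}=k$ (its window ends at a copy of $k$) and $\phi(v_{i'}v_{j'})=\phi(v_iv_j)$.
   Context: Let $c_i=1+t$ for $i\ge1$, where $2^t$ is the largest power of $2$ dividing $i$ (so $(c_i)$ begins $1,2,1,3,1,2,1,4,\dots$). Let $\mathbb{U}$ be the $\mathbb{F}_2$-vector space of binary sequences with finitely many $1$s and $e_j$ the vector whose only $1$ is in coordinate $j$. Put $a_i=e_{c_i}$ and $s_i=a_1+\cdots+a_i$ (with $s_0=0$). $P_n^\ell$ has vertices $v_0,\dots,v_{n-1}$, with $v_iv_j$ an edge iff $1\le|i-j|\le\ell$. The edge-coloring $\phi$ of $P_n^\ell$ is $\phi(v_iv_j)=s_i+s_j$, which for $i<j$ equals $a_{i+1}+\cdots+a_j$; the window corresponding to the edge $v_iv_j$ ($i<j$) is $(c_{i+1},\dots,c_j)$. -}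

module Defs where

open import Data.Nat using (ℕ; zero; suc; _+_; _≡ᵇ_; _/_; _%_)
open import Data.Bool using (Bool; true; false; _xor_; if_then_else_)

-- 2-adic valuation with fuel: ν₂ i = go i i (fuel i suffices for i ≥ 1).
ν₂-go : ℕ → ℕ → ℕ
ν₂-go zero    _ = 0
ν₂-go (suc f) zero = 0
ν₂-go (suc f) (suc m) =
  if (suc m % 2) ≡ᵇ 0 then suc (ν₂-go f (suc m / 2)) else 0

ν₂ : ℕ → ℕ
ν₂ i = ν₂-go i i

c : ℕ → ℕ
c i = suc (ν₂ i)

-- Elements of 𝕌 are represented as functions ℕ → Bool (coordinate m ↦ bit);
-- coordinates used are 1,2,3,...; e_j has its only 1 in coordinate j.
e : ℕ → ℕ → Bool
e j m = j ≡ᵇ m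

a : ℕ → ℕ → Bool
a i = e (c i)

s : ℕ → ℕ → Bool
s zero    m = false
s (suc i) m = s i m xor a (suc i) m

φ : ℕ → ℕ → ℕ → Bool
φ i j m = s i m xor s j m

-- Write the distinguished position of colour k = p + 1 in the window as t = 2^p (2q + 1).
-- The multiples 2^(p+1) q and 2^(p+1) (q + 1) have colour > k, so the window lies between
-- them: i = b + u and j = t + d with b = 2^(p+1) q and u, d < 2^p.  Away from multiples of
-- 2^p the sequence c is 2^p-periodic, so s (b + u) = s b + s u and s (t + d) = s t + s d;
-- moreover {s u | u < 2^p} is closed under addition (it is the span of e_1, …, e_p).
-- Taking u' < 2^p with s u' = s u + s d, the edge v_(b+u') v_t has the same colour and
-- length at most 2^p ≤ ℓ.
module Submission where

open import Defs
open import Data.Nat using (ℕ; zero; suc; _+_; _*_; _<_; _≤_; _∸_; _^_; _%_; _/_; _≡ᵇ_; z≤n; s≤s; z<s; s<s)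
open import Data.Nat.Properties
open import Data.Nat.DivMod using (m/n<m; m*n%n≡0; m*n/n≡m; [m+kn]%n≡m%n)
open import Data.Bool using (_xor_; if_then_else_)
open import Data.Bool.Properties using (xor-assoc; xor-same; xor-identityʳ; xor-∧-commutativeRing)
open import Algebra.Bundles using (CommutativeRing)
open import Algebra.Properties.CommutativeSemigroup (CommutativeRing.+-commutativeSemigroup xor-∧-commutativeRing)
  using (interchange; x∙yz≈y∙xz; xy∙z≈xz∙y)
open import Relation.Nullary using (yes; no)
open import Data.Product using (_×_; _,_; ∃-syntax)
open import Function using (_∘_)
open import Data.Sum using (_⊎_; inj₁; inj₂)
open import Data.Empty using (⊥-elim)
open import Relation.Binary.PropositionalEquality using (_≡_; refl; sym; trans; cong; cong₂; subst; module ≡-Reasoning)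

open ≡-Reasoning

ν₂-go-fuel-irrelevant : ∀ {f g x} → x ≤ f → x ≤ g → ν₂-go f x ≡ ν₂-go g x
ν₂-go-fuel-irrelevant {zero}  {zero}  {zero}  _ _ = refl
ν₂-go-fuel-irrelevant {zero}  {suc g} {zero}  _ _ = refl
ν₂-go-fuel-irrelevant {suc f} {zero}  {zero}  _ _ = refl
ν₂-go-fuel-irrelevant {suc f} {suc g} {zero}  _ _ = refl
ν₂-go-fuel-irrelevant {suc f} {suc g} {suc x} (s≤s x≤f) (s≤s x≤g) =
  cong (λ r → if suc x % 2 ≡ᵇ 0 then suc r else 0)
       (ν₂-go-fuel-irrelevant (≤-trans half≤x x≤f) (≤-trans half≤x x≤g))
  where
  half≤x : suc x / 2 ≤ x
  half≤x = ≤-pred (m/n<m (suc x) 2 (s≤s (s≤s z≤n)))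

ν₂-odd : ∀ m → suc m % 2 ≡ 1 → ν₂ (suc m) ≡ 0
ν₂-odd m odd rewrite odd = refl

ν₂-even : ∀ m → suc m % 2 ≡ 0 → ν₂ (suc m) ≡ suc (ν₂ (suc m / 2))
ν₂-even m even rewrite even = cong suc (ν₂-go-fuel-irrelevant half≤m ≤-refl)
  where
  half≤m : suc m / 2 ≤ m
  half≤m = ≤-pred (m/n<m (suc m) 2 (s≤s (s≤s z≤n)))

c-odd : ∀ q → c (suc (2 * q)) ≡ 1
c-odd q = cong suc (ν₂-odd (2 * q) (trans (cong (λ n → suc n % 2) (*-comm 2 q)) ([m+kn]%n≡m%n 1 q 2)))

c-double : ∀ x → 0 < x → c (2 * x) ≡ suc (c x)
c-double (suc x) _ = cong suc (begin
  ν₂ (2 * suc x)           ≡⟨ cong ν₂ (*-comm 2 (suc x)) ⟩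
  ν₂ (suc x * 2)           ≡⟨ ν₂-even (suc (x * 2)) (m*n%n≡0 (suc x) 2) ⟩
  suc (ν₂ (suc x * 2 / 2)) ≡⟨ cong (suc ∘ ν₂) (m*n/n≡m (suc x) 2) ⟩
  suc (ν₂ (suc x))         ∎)

even⊎odd : ∀ n → (∃[ q ] n ≡ 2 * q) ⊎ (∃[ q ] n ≡ suc (2 * q))
even⊎odd zero = inj₁ (0 , refl)
even⊎odd (suc n) with even⊎odd n
... | inj₁ (q , refl) = inj₂ (q , refl)
... | inj₂ (q , refl) = inj₁ (suc q , sym (*-suc 2 q))

2^p*m>0 : ∀ p {m} → 0 < m → 0 < 2 ^ p * m
2^p*m>0 p {suc m} _ = <-≤-trans (m^n>0 2 p) (m≤m*n (2 ^ p) (suc m))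

c-2^p*m : ∀ p {m} → 0 < m → c (2 ^ p * m) ≡ p + c m
c-2^p*m zero    {m} _   = cong c (*-identityˡ m)
c-2^p*m (suc p) {m} 0<m = begin
  c (2 ^ suc p * m)   ≡⟨ cong c (*-assoc 2 (2 ^ p) m) ⟩
  c (2 * (2 ^ p * m)) ≡⟨ c-double _ (2^p*m>0 p 0<m) ⟩
  suc (c (2 ^ p * m)) ≡⟨ cong suc (c-2^p*m p 0<m) ⟩
  suc (p + c m)       ∎

2^[1+p]*m+2x≡2*[2^p*m+x] : ∀ p m x → 2 ^ suc p * m + 2 * x ≡ 2 * (2 ^ p * m + x)
2^[1+p]*m+2x≡2*[2^p*m+x] p m x = trans (cong (_+ 2 * x) (*-assoc 2 (2 ^ p) m)) (sym (*-distribˡ-+ 2 (2 ^ p * m) x))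

c-periodic : ∀ p m {y} → 0 < y → y < 2 ^ p → c (2 ^ p * m + y) ≡ c y
c-periodic zero    m (s≤s z≤n) (s≤s ())
c-periodic (suc p) m {y} 0<y y< with even⊎odd y
c-periodic (suc p) m () _  | inj₁ (zero , refl)
c-periodic (suc p) m _  y< | inj₁ (x@(suc _) , refl) = begin
  c (2 ^ suc p * m + 2 * x) ≡⟨ cong c (2^[1+p]*m+2x≡2*[2^p*m+x] p m x) ⟩
  c (2 * (2 ^ p * m + x))   ≡⟨ c-double _ (<-≤-trans z<s (m≤n+m x (2 ^ p * m))) ⟩
  suc (c (2 ^ p * m + x))   ≡⟨ cong suc (c-periodic p m z<s (*-cancelˡ-< 2 x (2 ^ p) y<)) ⟩
  suc (c x)                 ≡⟨ sym (c-double x z<s) ⟩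
  c (2 * x)                 ∎
c-periodic (suc p) m _  _  | inj₂ (x , refl) = begin
  c (2 ^ suc p * m + suc (2 * x))  ≡⟨ cong c (trans (+-suc (2 ^ suc p * m) (2 * x)) (cong suc (2^[1+p]*m+2x≡2*[2^p*m+x] p m x))) ⟩
  c (suc (2 * (2 ^ p * m + x)))    ≡⟨ c-odd (2 ^ p * m + x) ⟩
  1                                ≡⟨ sym (c-odd x) ⟩
  c (suc (2 * x))                  ∎

-- The hypothesis 0 < t excludes the junk value c 0 = 1.
c≡1+p⇒2^p*odd : ∀ p {t} → 0 < t → c t ≡ suc p → ∃[ q ] t ≡ 2 ^ p * suc (2 * q)
c≡1+p⇒2^p*odd p {t} 0<t ct with even⊎odd t
c≡1+p⇒2^p*odd p       () _  | inj₁ (zero , refl)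
c≡1+p⇒2^p*odd zero    _  ct | inj₁ (suc x , refl) = ⊥-elim (1+n≢0 (suc-injective (trans (sym (c-double (suc x) z<s)) ct)))
c≡1+p⇒2^p*odd (suc p) _  ct | inj₁ (x@(suc _) , refl)
  with q , x≡ ← c≡1+p⇒2^p*odd p z<s (suc-injective (trans (sym (c-double x z<s)) ct))
  = q , trans (cong (2 *_) x≡) (sym (*-assoc 2 (2 ^ p) _))
c≡1+p⇒2^p*odd zero    _  _  | inj₂ (q , refl) = q , sym (*-identityˡ _)
c≡1+p⇒2^p*odd (suc p) _  ct | inj₂ (q , refl) = ⊥-elim (0≢1+n (suc-injective {0} (trans (sym (c-odd q)) ct)))

s-split : ∀ p m {v} → v < 2 ^ p → ∀ x → s (2 ^ p * m + v) x ≡ s (2 ^ p * m) x xor s v x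
s-split p m {zero}  _  x = trans (cong (λ n → s n x) (+-identityʳ (2 ^ p * m))) (sym (xor-identityʳ (s (2 ^ p * m) x)))
s-split p m {suc v} v< x = begin
  s (2 ^ p * m + suc v) x                         ≡⟨ cong (λ n → s n x) (+-suc (2 ^ p * m) v) ⟩
  s (2 ^ p * m + v) x xor a (suc (2 ^ p * m + v)) x
    ≡⟨ cong₂ _xor_ (s-split p m (<-trans (n<1+n v) v<) x) (cong (λ n → e n x) same-colour) ⟩
  (s (2 ^ p * m) x xor s v x) xor a (suc v) x     ≡⟨ xor-assoc (s (2 ^ p * m) x) (s v x) (a (suc v) x) ⟩
  s (2 ^ p * m) x xor s (suc v) x                 ∎
  where
  same-colour : c (suc (2 ^ p * m + v)) ≡ c (suc v)
  same-colour = trans (cong c (sym (+-suc (2 ^ p * m) v))) (c-periodic p m z<s v<)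

s-2^p+y : ∀ p {y} → y < 2 ^ p → ∀ x → s (2 ^ p + y) x ≡ s (2 ^ p) x xor s y x
s-2^p+y p {y} y< x = subst (λ n → s (n + y) x ≡ s n x xor s y x) (*-identityʳ (2 ^ p)) (s-split p 1 y< x)

offset< : ∀ {b w n} → b ≤ n → n < b + w → ∃[ y ] (y < w × n ≡ b + y)
offset< {b} {w} {n} b≤n n< =
  n ∸ b , +-cancelˡ-< b (n ∸ b) w (subst (_< b + w) n≡ n<) , n≡
  where
  n≡ : n ≡ b + (n ∸ b)
  n≡ = sym (m+[n∸m]≡n b≤n)

low⊎high : ∀ p {u} → u < 2 ^ suc p → u < 2 ^ p ⊎ ∃[ y ] (y < 2 ^ p × u ≡ 2 ^ p + y)
low⊎high p {u} u< with u <? 2 ^ p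
... | yes u<P = inj₁ u<P
... | no  u≮P = inj₂ (offset< (≮⇒≥ u≮P) (subst (u <_) (cong (2 ^ p +_) (+-identityʳ (2 ^ p))) u<))

<2^p⇒<2^[1+p] : ∀ p {d} → d < 2 ^ p → d < 2 ^ suc p
<2^p⇒<2^[1+p] p d< = <-≤-trans d< (m≤m+n (2 ^ p) _)

<2^p⇒2^p+<2^[1+p] : ∀ p {d} → d < 2 ^ p → 2 ^ p + d < 2 ^ suc p
<2^p⇒2^p+<2^[1+p] p d< = +-monoʳ-< (2 ^ p) (<-≤-trans d< (m≤m+n (2 ^ p) 0))

s-xor-closed : ∀ p {u₁ u₂} → u₁ < 2 ^ p → u₂ < 2 ^ p →
               ∃[ d ] (d < 2 ^ p × ∀ x → s d x ≡ s u₁ x xor s u₂ x)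
s-xor-closed zero (s≤s z≤n) (s≤s z≤n) = 0 , z<s , λ _ → refl
s-xor-closed (suc p) {u₁} {u₂} u₁< u₂< with low⊎high p u₁< | low⊎high p u₂<
... | inj₁ l₁ | inj₁ l₂
  with d , d< , sd ← s-xor-closed p l₁ l₂ = d , <2^p⇒<2^[1+p] p d< , sd
... | inj₂ (y₁ , y₁< , refl) | inj₁ l₂
  with d , d< , sd ← s-xor-closed p y₁< l₂ = 2 ^ p + d , <2^p⇒2^p+<2^[1+p] p d< , λ x → begin
    s (2 ^ p + d) x                     ≡⟨ s-2^p+y p d< x ⟩
    s (2 ^ p) x xor s d x               ≡⟨ cong (s (2 ^ p) x xor_) (sd x) ⟩
    s (2 ^ p) x xor (s y₁ x xor s u₂ x) ≡⟨ xor-assoc (s (2 ^ p) x) (s y₁ x) (s u₂ x) ⟨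
    (s (2 ^ p) x xor s y₁ x) xor s u₂ x ≡⟨ cong (_xor s u₂ x) (s-2^p+y p y₁< x) ⟨
    s (2 ^ p + y₁) x xor s u₂ x         ∎
... | inj₁ l₁ | inj₂ (y₂ , y₂< , refl)
  with d , d< , sd ← s-xor-closed p l₁ y₂< = 2 ^ p + d , <2^p⇒2^p+<2^[1+p] p d< , λ x → begin
    s (2 ^ p + d) x                     ≡⟨ s-2^p+y p d< x ⟩
    s (2 ^ p) x xor s d x               ≡⟨ cong (s (2 ^ p) x xor_) (sd x) ⟩
    s (2 ^ p) x xor (s u₁ x xor s y₂ x) ≡⟨ x∙yz≈y∙xz (s (2 ^ p) x) (s u₁ x) (s y₂ x) ⟩
    s u₁ x xor (s (2 ^ p) x xor s y₂ x) ≡⟨ cong (s u₁ x xor_) (s-2^p+y p y₂< x) ⟨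
    s u₁ x xor s (2 ^ p + y₂) x         ∎
... | inj₂ (y₁ , y₁< , refl) | inj₂ (y₂ , y₂< , refl)
  with d , d< , sd ← s-xor-closed p y₁< y₂< = d , <2^p⇒<2^[1+p] p d< , λ x →
    let S = s (2 ^ p) x in begin
    s d x                                    ≡⟨ sd x ⟩
    s y₁ x xor s y₂ x                        ≡⟨ cong (_xor (s y₁ x xor s y₂ x)) (xor-same S) ⟨
    (S xor S) xor (s y₁ x xor s y₂ x)        ≡⟨ interchange S S (s y₁ x) (s y₂ x) ⟩
    (S xor s y₁ x) xor (S xor s y₂ x)        ≡⟨ cong₂ _xor_ (s-2^p+y p y₁< x) (s-2^p+y p y₂< x) ⟨
    s (2 ^ p + y₁) x xor s (2 ^ p + y₂) x    ∎

2^p*[1+m]≡2^p*m+2^p : ∀ p m → 2 ^ p * suc m ≡ 2 ^ p * m + 2 ^ p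
2^p*[1+m]≡2^p*m+2^p p m = trans (*-suc (2 ^ p) m) (+-comm (2 ^ p) (2 ^ p * m))

1+p<c[2^p*2m] : ∀ p {m} → 0 < m → suc p < c (2 ^ p * (2 * m))
1+p<c[2^p*2m] p {m} 0<m = subst (suc p <_) (sym c≡) (s<s (m<m+n p z<s))
  where
  c≡ : c (2 ^ p * (2 * m)) ≡ suc (p + c m)
  c≡ = trans (c-2^p*m p (<-≤-trans 0<m (m≤m+n m _)))
             (trans (cong (p +_) (c-double m 0<m)) (+-suc p (c m)))

bounded-window-ends-before : ∀ {k i j t} → (∀ t → i < t → t ≤ j → c t ≤ k) →
                             k < c t → i < t → j < t
bounded-window-ends-before {j = j} {t} bounded k<ct i<t with t ≤? j
... | yes t≤j = ⊥-elim (<⇒≱ k<ct (bounded t i<t t≤j))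
... | no  t≰j = ≰⇒> t≰j

window-start : ∀ p q {i j} → (∀ t → i < t → t ≤ j → c t ≤ suc p) →
               i < 2 ^ p * suc (2 * q) → 2 ^ p * suc (2 * q) ≤ j → 2 ^ p * (2 * q) ≤ i
window-start p zero {i} _ _ _ = subst (_≤ i) (sym (*-zeroʳ (2 ^ p))) z≤n
window-start p (suc q) bounded i<t t≤j = ≮⇒≥ λ i<b →
  <⇒≱ (bounded-window-ends-before bounded (1+p<c[2^p*2m] p z<s) i<b)
      (≤-trans (*-monoʳ-≤ (2 ^ p) (n≤1+n _)) t≤j)

window-end : ∀ p q {i j} → (∀ t → i < t → t ≤ j → c t ≤ suc p) →
             i < 2 ^ p * suc (2 * q) → j < 2 ^ p * suc (2 * q) + 2 ^ p
window-end p q bounded i<t =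
  bounded-window-ends-before bounded 1+p<c (<-≤-trans i<t (m≤m+n _ (2 ^ p)))
  where
  1+p<c : suc p < c (2 ^ p * suc (2 * q) + 2 ^ p)
  1+p<c = subst (λ n → suc p < c n)
                (trans (cong (2 ^ p *_) (*-suc 2 q)) (2^p*[1+m]≡2^p*m+2^p p (suc (2 * q))))
                (1+p<c[2^p*2m] p {suc q} z<s)

φ-ending-at-multiple : ∀ p m₁ m₂ {u d} → u < 2 ^ p → d < 2 ^ p →
           ∃[ u' ] (u' < 2 ^ p × ∀ x → φ (2 ^ p * m₁ + u') (2 ^ p * m₂) x
                                      ≡ φ (2 ^ p * m₁ + u) (2 ^ p * m₂ + d) x)
φ-ending-at-multiple p m₁ m₂ {u} {d} u< d< with u' , u'< , su' ← s-xor-closed p u< d< = u' , u'< , λ x →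
  let B = s (2 ^ p * m₁) x
      T = s (2 ^ p * m₂) x
  in begin
  s (2 ^ p * m₁ + u') x xor T      ≡⟨ cong (_xor T) (s-split p m₁ u'< x) ⟩
  (B xor s u' x) xor T             ≡⟨ cong (λ z → (B xor z) xor T) (su' x) ⟩
  (B xor (s u x xor s d x)) xor T  ≡⟨ xy∙z≈xz∙y B (s u x xor s d x) T ⟩
  (B xor T) xor (s u x xor s d x)  ≡⟨ interchange B T (s u x) (s d x) ⟩
  (B xor s u x) xor (T xor s d x)  ≡⟨ cong₂ _xor_ (s-split p m₁ u< x) (s-split p m₂ d< x) ⟨
  s (2 ^ p * m₁ + u) x xor s (2 ^ p * m₂ + d) x ∎

lemma4p5 : (n ℓ k : ℕ) → 0 < n → 0 < ℓ → 0 < k → 2 ^ (k ∸ 1) ≤ ℓ →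
    (i j : ℕ) → i < j → j < n → j ∸ i ≤ ℓ →
    (∀ t → i < t → t ≤ j → c t ≤ k) →
    (∃[ t ] (i < t × t ≤ j × c t ≡ k)) →
    ∃[ i' ] ∃[ j' ] (i' < j' × j' < n × j' ∸ i' ≤ ℓ × c j' ≡ k ×
    (∀ m → φ i' j' m ≡ φ i j m))
lemma4p5 n ℓ zero    _ _ () _ _ _ _ _ _ _ _
lemma4p5 n ℓ (suc p) _ _ _ 2^p≤ℓ i j _ j<n _ bounded (t , i<t , t≤j , ct)
  with q , refl ← c≡1+p⇒2^p*odd p (≤-<-trans z≤n i<t) ct
  with u , u< , refl ← offset< (window-start p q bounded i<t t≤j)
                               (subst (i <_) (2^p*[1+m]≡2^p*m+2^p p (2 * q)) i<t)
  with d , d< , refl ← offset< t≤j (window-end p q bounded i<t)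
  with u' , u'< , same-φ ← φ-ending-at-multiple p (2 * q) (suc (2 * q)) u< d<
  = b + u' , _ , i'<t , ≤-<-trans (m≤m+n _ d) j<n , t∸i'≤ℓ , ct , same-φ
  where
  b : ℕ
  b = 2 ^ p * (2 * q)
  t≡b+2^p : 2 ^ p * suc (2 * q) ≡ b + 2 ^ p
  t≡b+2^p = 2^p*[1+m]≡2^p*m+2^p p (2 * q)
  i'<t : b + u' < 2 ^ p * suc (2 * q)
  i'<t = subst (b + u' <_) (sym t≡b+2^p) (+-monoʳ-< b u'<)
  t∸i'≤ℓ : 2 ^ p * suc (2 * q) ∸ (b + u') ≤ ℓ
  t∸i'≤ℓ = subst (λ n → n ∸ (b + u') ≤ ℓ) (sym t≡b+2^p)
             (subst (_≤ ℓ) (sym ([m+n]∸[m+o]≡n∸o b (2 ^ p) u')) (≤-trans (m∸n≤m (2 ^ p) u') 2^p≤ℓ))
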